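{- Let $G$ be a weighted game arena with partial observation and $\ell_{\max}\in\mathbb{N}_0$. Let $S\subseteq\mathcal{F}$ be upward-closed and $f,g\in\mathcal{F}\setminus\mathcal{U}$. If $f\in\mathrm{UPre}(S)$ and $f\preceq g$, then $g\in\mathrm{UPre}(S)$.
   Context: A WGA is $G=\langle Q,q_I,\Sigma,\Delta,w,Obs\rangle$ with $Q$ a finite set of states, $\Sigma$ a finite set of actions, $\Delta\subseteq Q\times\Sigma\times Q$ a total transition relation, $w:\Delta\to\mathbb{Z}$, $Obs$ a partition of $Q$; $W=\max\{|w(t)|:t\in\Delta\}$; $\mathrm{post}_\sigma(s)=\{q':\exists q\in s,(q,\sigma,q')\in\Delta\}$. $\mathbb{N}_0=\{1,2,\dots\}$. $\mathcal{F}$ is the set of all functions $f:Q\to(\{1,\dots,\ell_{\max}\}\to\{ -W\ell_{\max},\dots,0\})\cup\{\bot\}$; $\mathrm{supp}(f)=\{q:f(q)\ne\bot\}$, $f(q)_i=f(q)(i)$. For $\sigma\in\Sigma$, $f_2$ is a $\sigma$-successor of $f_1$ if $\mathrm{supp}(f_2)=\mathrm{post}_\sigma(\mathrm{supp}(f_1))\cap o$ for some $o\in Obs$ and for all $q\in\mathrm{supp}(f_2)$, $1\le j\le\ell_{\max}$: $f_2(q)_j=\max\{ -W\ell_{\max},\min\{0,\zeta_j(q)\}\}$ with $\zeta_1(q)=\min\{w(p,\sigma,q):p\in\mathrm{supp}(f_1),(p,\sigma,q)\in\Delta\}$ and, for $j\ge2$, $\zeta_j(q)=\min\{f_1(p)_{j-1}+w(p,\sigma,q):p\in\mathrm{supp}(f_1),(p,\sigma,q)\in\Delta,f_1(p)_{j-1}<0\}$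 ($\min\emptyset=+\infty$). $\mathrm{UPre}(S)=\{p\in\mathcal{F}:\forall\sigma\in\Sigma\ \exists q\in S,\ q\text{ is a }\sigma\text{ -successor of }p\}$. $\mathcal{U}=\{f\in\mathcal{F}:\exists q\in\mathrm{supp}(f),f(q)_{\ell_{\max}}<0\}$. For $f,g\in\mathcal{F}$, $f\preceq g$ iff $\mathrm{supp}(f)\subseteq\mathrm{supp}(g)$ and for all $q\in\mathrm{supp}(f)$ and all $i\in\{1,\dots,\ell_{\max}\}$ there is $j\in\{i,\dots,\ell_{\max}\}$ with $f(q)_i\ge g(q)_j$. A set $S\subseteq\mathcal{F}$ is upward-closed if $S=\{t\in\mathcal{F}:\exists s\in S,\ s\preceq t\}$. -}

module Defs where

open import Data.Nat using (ℕ; suc)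
open import Data.Fin using (Fin; zero; suc; inject₁; fromℕ) renaming (_≤_ to _≤ᶠ_)
open import Data.Integer using (ℤ; +_; -_; _+_; _⊓_; _⊔_; _<?_; ∣_∣) renaming (_≤_ to _≤ℤ_; _<_ to _<ℤ_)
open import Data.List using (List; foldr; map; allFin; concatMap)
open import Data.Maybe using (Maybe; just; nothing)
open import Data.Product using (Σ; ∃; ∃-syntax; _×_; _,_)
open import Data.Bool using (if_then_else_)
open import Relation.Nullary using (¬_; does)
open import Relation.Binary.PropositionalEquality using (_≡_)

0ℤ : ℤ
0ℤ = + 0

-- Q = Fin n, Σ = Fin m.  Δ together with w is encoded by
--   trans p σ q ≡ just z   iff  (p,σ,q) ∈ Δ and w(p,σ,q) = z,
--   trans p σ q ≡ nothing  iff  (p,σ,q) ∉ Δ.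
-- Obs is a partition of Q into k (nonempty) blocks, given by the
-- block-index map obs : Q → Fin k, required to be surjective.

record WGA : Set where
  field
    n m k    : ℕ
    qI       : Fin n
    trans    : Fin n → Fin m → Fin n → Maybe ℤ
    total    : ∀ p σ → ∃[ q ] ∃[ z ] (trans p σ q ≡ just z)
    obs      : Fin n → Fin k
    obs-surj : ∀ (o : Fin k) → ∃[ q ] (obs q ≡ o)

module _ (G : WGA) where
  open WGA G

  InΔ : Fin n → Fin m → Fin n → Set
  InΔ p σ q = ∃[ z ] (trans p σ q ≡ just z)

  W : ℕ
  W = foldr Data.Nat._⊔_ 0
        (concatMap (λ p → concatMap (λ σ → map (λ q → absw (trans p σ q)) (allFin n)) (allFin m)) (allFin n))
    where
      absw : Maybe ℤ → ℕ
      absw (just z) = ∣ z ∣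
      absw nothing  = 0

  -- raw candidates for elements of 𝓕 (with ℓmax = ℓ); index i ∈ {1..ℓ} is Fin ℓ (i-1)
  RawF : ℕ → Set
  RawF ℓ = Fin n → Maybe (Fin ℓ → ℤ)

  lowB : ℕ → ℤ
  lowB ℓ = - (+ (W Data.Nat.* ℓ))

  InF : ∀ {ℓ} → RawF ℓ → Set
  InF {ℓ} f = ∀ q v → f q ≡ just v → ∀ i → (lowB ℓ ≤ℤ v i) × (v i ≤ℤ 0ℤ)

  Supp : ∀ {ℓ} → RawF ℓ → Fin n → Set
  Supp f q = ∃[ v ] (f q ≡ just v)

  PostObs : ∀ {ℓ} → RawF ℓ → Fin m → Fin k → Fin n → Set
  PostObs f σ o q = (∃[ p ] (Supp f p × InΔ p σ q)) × (obs q ≡ o)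

  -- minimum over a finite set of integers, nothing = +∞ (min ∅ = +∞)
  minM : Maybe ℤ → Maybe ℤ → Maybe ℤ
  minM nothing  y        = y
  minM (just a) nothing  = just a
  minM (just a) (just b) = just (a ⊓ b)

  minOver : (Fin n → Maybe ℤ) → Maybe ℤ
  minOver g = foldr minM nothing (map g (allFin n))

  ζ : ∀ {ℓ} → RawF ℓ → Fin m → Fin n → Fin ℓ → Maybe ℤ
  ζ f σ q zero    = minOver λ p → term (f p) (trans p σ q)
    where
      term : ∀ {A : Set} → Maybe A → Maybe ℤ → Maybe ℤ
      term (just _) (just z) = just z
      term _        _        = nothing
  ζ f σ q (suc j) = minOver λ p → term (f p) (trans p σ q)
    where
      term : Maybe (Fin _ → ℤ) → Maybe ℤ → Maybe ℤ
      term (just v) (just z) = if does (v (inject₁ j) <? 0ℤ) then just (v (inject₁ j) + z) else nothing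
      term _        _        = nothing

  clamp : ℕ → Maybe ℤ → ℤ
  clamp ℓ nothing  = lowB ℓ ⊔ 0ℤ
  clamp ℓ (just z) = lowB ℓ ⊔ (0ℤ ⊓ z)

  Successor : ∀ {ℓ} → Fin m → RawF ℓ → RawF ℓ → Set
  Successor {ℓ} σ f₁ f₂ =
    ∃[ o ] ( (∀ q → (Supp f₂ q → PostObs f₁ σ o q) × (PostObs f₁ σ o q → Supp f₂ q))
           × (∀ q v → f₂ q ≡ just v → ∀ j → v j ≡ clamp ℓ (ζ f₁ σ q j)) )

  UPre : ∀ {ℓ} → (RawF ℓ → Set) → RawF ℓ → Set
  UPre S p = InF p × (∀ σ → ∃[ q ] (S q × Successor σ p q))

  𝓤 : ∀ {l} → RawF (suc l) → Set
  𝓤 {l} f = InF f × ∃[ q ] ∃[ v ] ((f q ≡ just v) × (v (fromℕ l) <ℤ 0ℤ))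

  _⪯_ : ∀ {ℓ} → RawF ℓ → RawF ℓ → Set
  f ⪯ g = (∀ q → Supp f q → Supp g q)
        × (∀ q u v → f q ≡ just u → g q ≡ just v →
             ∀ i → ∃[ j ] ((i ≤ᶠ j) × (v j ≤ℤ u i)))

  UpwardClosed : ∀ {ℓ} → (RawF ℓ → Set) → Set
  UpwardClosed S = ∀ t → (S t → InF t × ∃[ s ] (S s × s ⪯ t))
                       × (InF t × ∃[ s ] (S s × s ⪯ t) → S t)

-- The successor map is monotone in ⪯ away from 𝓤.  Take the σ-successor q of f
-- that lies in S, with observation o, and let q' be the σ-successor of g with the
-- same observation o.  Since supp f ⊆ supp g, supp q ⊆ supp q'.  Entry 1 of q' is
-- a minimum over a larger set of predecessors than entry 1 of q.  Entry i+1 of q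
-- at x is attained at some f(p)ᵢ + w(p,σ,x) with f(p)ᵢ < 0; f ⪯ g gives j ≥ i with
-- g(p)ⱼ ≤ f(p)ᵢ < 0, and j < ℓmax because g ∉ 𝓤, so g(p)ⱼ + w(p,σ,x) bounds entry
-- j+1 of q'.  Clamping is monotone, hence q ⪯ q', and q' ∈ S by upward closure.
module Submission where

open import Defs
open import Data.Nat using (ℕ; suc)
open import Data.Product using (_×_)
open import Relation.Nullary using (¬_)

open import Data.Empty using (⊥-elim)
open import Data.Fin using (Fin; zero; suc; inject₁; fromℕ) renaming (_≤_ to _≤ᶠ_; _≟_ to _≟ᶠ_)
open import Data.Fin.Properties using (any?; toℕ-inject₁)
open import Data.Integer using (ℤ; _+_; _<?_) renaming (_≤_ to _≤ℤ_; _<_ to _<ℤ_)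
import Data.Integer.Properties as ℤ
open import Data.List using (_∷_; foldr; map; allFin)
open import Data.List.Membership.Propositional using (_∈_)
open import Data.List.Membership.Propositional.Properties using (∈-map⁺; ∈-map⁻; ∈-allFin)
open import Data.List.Relation.Unary.Any using (here; there)
open import Data.Maybe using (Maybe; just; nothing)
open import Data.Nat.Properties using (≤-refl)
import Data.Nat as ℕ
open import Data.Product using (∃-syntax; _,_; proj₁; proj₂)
open import Data.Sum using (_⊎_; inj₁; inj₂)
open import Relation.Nullary using (Dec; yes; no; _×-dec_)
open import Relation.Nullary.Decidable using (dec-true)
open import Relation.Binary.PropositionalEquality using (_≡_; refl; sym; cong; subst₂) renaming (trans to ≡-trans)

-- nothing stands for +∞, as in minOver
infix 4 _≤∞_
data _≤∞_ : Maybe ℤ → Maybe ℤ → Set where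
  ≤∞-top  : ∀ {a} → a ≤∞ nothing
  ≤∞-just : ∀ {a b} → a ≤ℤ b → just a ≤∞ just b

≤∞-refl : ∀ a → a ≤∞ a
≤∞-refl nothing  = ≤∞-top
≤∞-refl (just a) = ≤∞-just ℤ.≤-refl

≤∞-trans : ∀ {a b c} → a ≤∞ b → b ≤∞ c → a ≤∞ c
≤∞-trans _           ≤∞-top      = ≤∞-top
≤∞-trans (≤∞-just p) (≤∞-just q) = ≤∞-just (ℤ.≤-trans p q)

isJust? : ∀ {A : Set} (x : Maybe A) → Dec (∃[ v ] (x ≡ just v))
isJust? (just v) = yes (v , refl)
isJust? nothing  = no λ ()

guarded : ∀ {P B : Set} → Dec P → B → Maybe B
guarded (yes _) b = just b
guarded (no _)  _ = nothing

guarded-just⁻¹ : ∀ {P B : Set} (d : Dec P) (b : B) {v} → guarded d b ≡ just v → P × (v ≡ b)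
guarded-just⁻¹ (yes p) b refl = p , refl

guarded-just : ∀ {P B : Set} (d : Dec P) (b : B) → P → ∃[ v ] (guarded d b ≡ just v)
guarded-just (yes _) b _ = b , refl
guarded-just (no ¬p) b p = ⊥-elim (¬p p)

fromℕ-or-inject₁ : ∀ l (j : Fin (suc l)) → (j ≡ fromℕ l) ⊎ (∃[ j' ] (j ≡ inject₁ j'))
fromℕ-or-inject₁ ℕ.zero  zero    = inj₁ refl
fromℕ-or-inject₁ (suc l) zero    = inj₂ (zero , refl)
fromℕ-or-inject₁ (suc l) (suc j) with fromℕ-or-inject₁ l j
... | inj₁ j≡last       = inj₁ (cong suc j≡last)
... | inj₂ (j' , j≡j') = inj₂ (suc j' , cong suc j≡j')

inject₁-≤⁻¹ : ∀ {l} {i j : Fin l} → inject₁ i ≤ᶠ inject₁ j → i ≤ᶠ j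
inject₁-≤⁻¹ {i = i} {j} = subst₂ ℕ._≤_ (toℕ-inject₁ i) (toℕ-inject₁ j)

module _ (G : WGA) where
  open WGA G

  minM-≤∞ˡ : ∀ a b → minM G a b ≤∞ a
  minM-≤∞ˡ nothing  b        = ≤∞-top
  minM-≤∞ˡ (just a) nothing  = ≤∞-refl (just a)
  minM-≤∞ˡ (just a) (just b) = ≤∞-just (ℤ.i⊓j≤i a b)

  minM-≤∞ʳ : ∀ a b → minM G a b ≤∞ b
  minM-≤∞ʳ nothing  b        = ≤∞-refl b
  minM-≤∞ʳ (just a) nothing  = ≤∞-top
  minM-≤∞ʳ (just a) (just b) = ≤∞-just (ℤ.i⊓j≤j a b)

  minM-sel : ∀ a b {z} → minM G a b ≡ just z → (a ≡ just z) ⊎ (b ≡ just z)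
  minM-sel nothing  b        e = inj₂ e
  minM-sel (just a) nothing  e = inj₁ e
  minM-sel (just a) (just b) e with ℤ.⊓-sel a b
  ... | inj₁ a⊓b≡a = inj₁ (≡-trans (cong just (sym a⊓b≡a)) e)
  ... | inj₂ a⊓b≡b = inj₂ (≡-trans (cong just (sym a⊓b≡b)) e)

  foldr-minM-≤∞ : ∀ {xs y} → y ∈ xs → foldr (minM G) nothing xs ≤∞ y
  foldr-minM-≤∞ {x ∷ _}  (here refl) = minM-≤∞ˡ x _
  foldr-minM-≤∞ {x ∷ xs} (there y∈) = ≤∞-trans (minM-≤∞ʳ x _) (foldr-minM-≤∞ y∈)

  foldr-minM-∈ : ∀ xs {z} → foldr (minM G) nothing xs ≡ just z → just z ∈ xs
  foldr-minM-∈ (x ∷ xs) e with minM-sel x _ e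
  ... | inj₁ x≡z  = here (sym x≡z)
  ... | inj₂ xs≡z = there (foldr-minM-∈ xs xs≡z)

  minOver-≤∞ : (h : Fin n → Maybe ℤ) → ∀ p → minOver G h ≤∞ h p
  minOver-≤∞ h p = foldr-minM-≤∞ (∈-map⁺ h (∈-allFin p))

  minOver-attained : (h : Fin n → Maybe ℤ) {z : ℤ} → minOver G h ≡ just z → ∃[ p ] (h p ≡ just z)
  minOver-attained h e with ∈-map⁻ h (foldr-minM-∈ (map h (allFin n)) e)
  ... | p , _ , z≡hp = p , sym z≡hp

  module _ {l : ℕ} where

    -- The summands of ζ are built by a function local to Defs, which cannot be
    -- named here; these bounds leave it to be inferred.
    ζ-zero-≤∞-summand : (f : RawF G (suc l)) → ∀ σ x p → ζ G f σ x zero ≤∞ _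
    ζ-zero-≤∞-summand f σ x p = minOver-≤∞ _ p

    ζ-suc-≤∞-summand : (f : RawF G (suc l)) → ∀ σ x j p → ζ G f σ x (suc j) ≤∞ _
    ζ-suc-≤∞-summand f σ x j p = minOver-≤∞ _ p

    ζ-zero-≤∞ : (f : RawF G (suc l)) → ∀ σ x p {b w} → f p ≡ just b → trans p σ x ≡ just w →
                ζ G f σ x zero ≤∞ just w
    ζ-zero-≤∞ f σ x p eb ew with f p | trans p σ x | eb | ew | ζ-zero-≤∞-summand f σ x p
    ... | _ | _ | refl | refl | ζ≤ = ζ≤

    ζ-suc-≤∞ : (f : RawF G (suc l)) → ∀ σ x j p {b w} → f p ≡ just b → trans p σ x ≡ just w →
               b (inject₁ j) <ℤ 0ℤ → ζ G f σ x (suc j) ≤∞ just (b (inject₁ j) + w)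
    ζ-suc-≤∞ f σ x j p {b} eb ew neg with f p | trans p σ x | eb | ew | ζ-suc-≤∞-summand f σ x j p
    ... | _ | _ | refl | refl | ζ≤ rewrite dec-true (b (inject₁ j) <? 0ℤ) neg = ζ≤

    ζ-zero-attained : (f : RawF G (suc l)) → ∀ σ x {z} → ζ G f σ x zero ≡ just z →
                      ∃[ p ] (Supp G f p × trans p σ x ≡ just z)
    ζ-zero-attained f σ x e with minOver-attained _ e
    ... | p , e′ with f p in ef | trans p σ x in et | e′
    ... | just a | just w | refl = p , (a , ef) , et

    ζ-suc-attained : (f : RawF G (suc l)) → ∀ σ x j {z} → ζ G f σ x (suc j) ≡ just z →
                     ∃[ p ] ∃[ a ] ∃[ w ] ((f p ≡ just a) × (trans p σ x ≡ just w) ×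
                       (a (inject₁ j) <ℤ 0ℤ) × (z ≡ a (inject₁ j) + w))
    ζ-suc-attained f σ x j e with minOver-attained _ e
    ... | p , e′ with f p in ef | trans p σ x in et | e′
    ... | just a | just w | e″ with a (inject₁ j) <? 0ℤ | e″
    ... | yes neg | refl = p , a , w , ef , et , neg , refl

  module _ {ℓ : ℕ} where

    clamp-mono : ∀ {a b} → a ≤∞ b → clamp G ℓ a ≤ℤ clamp G ℓ b
    clamp-mono {nothing} ≤∞-top      = ℤ.≤-refl
    clamp-mono {just z}  ≤∞-top      = ℤ.⊔-monoʳ-≤ (lowB G ℓ) (ℤ.i⊓j≤i 0ℤ z)
    clamp-mono           (≤∞-just p) = ℤ.⊔-monoʳ-≤ (lowB G ℓ) (ℤ.⊓-monoʳ-≤ 0ℤ p)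

    clamp-bounds : ∀ a → (lowB G ℓ ≤ℤ clamp G ℓ a) × (clamp G ℓ a ≤ℤ 0ℤ)
    clamp-bounds nothing  = ℤ.i≤i⊔j _ _ , ℤ.⊔-lub ℤ.neg-≤-pos ℤ.≤-refl
    clamp-bounds (just z) = ℤ.i≤i⊔j _ _ , ℤ.⊔-lub ℤ.neg-≤-pos (ℤ.i⊓j≤i 0ℤ z)

    PostObs? : (f : RawF G ℓ) → ∀ σ o x → Dec (PostObs G f σ o x)
    PostObs? f σ o x = any? (λ p → isJust? (f p) ×-dec isJust? (trans p σ x)) ×-dec (obs x ≟ᶠ o)

    PostObs-mono : {f g : RawF G ℓ} → (∀ q → Supp G f q → Supp G g q) →
                   ∀ {σ o x} → PostObs G f σ o x → PostObs G g σ o x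
    PostObs-mono f⊆g ((p , sp , pσx) , ox) = (p , f⊆g p sp , pσx) , ox

    successor : RawF G ℓ → Fin m → Fin k → RawF G ℓ
    successor f σ o x = guarded (PostObs? f σ o x) (λ j → clamp G ℓ (ζ G f σ x j))

    successor-value : (f : RawF G ℓ) → ∀ σ o x v → successor f σ o x ≡ just v →
                      ∀ j → v j ≡ clamp G ℓ (ζ G f σ x j)
    successor-value f σ o x v e j with guarded-just⁻¹ (PostObs? f σ o x) _ e
    ... | _ , refl = refl

    successor-isSuccessor : (f : RawF G ℓ) → ∀ σ o → Successor G σ f (successor f σ o)
    successor-isSuccessor f σ o =
      o , (λ x → (λ (_ , e) → proj₁ (guarded-just⁻¹ (PostObs? f σ o x) _ e))
               , guarded-just (PostObs? f σ o x) _)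
        , successor-value f σ o

    successor-InF : (f : RawF G ℓ) → ∀ σ o → InF G (successor f σ o)
    successor-InF f σ o x v e j rewrite successor-value f σ o x v e j = clamp-bounds (ζ G f σ x j)

  module _ {l : ℕ} {f g : RawF G (suc l)} (g∈𝓕 : InF G g) (g∉𝓤 : ¬ 𝓤 G g) (f⪯g : _⪯_ G f g) where

    ζ-zero-⪯ : ∀ σ x → ζ G g σ x zero ≤∞ ζ G f σ x zero
    ζ-zero-⪯ σ x with ζ G f σ x zero in e
    ... | nothing = ≤∞-top
    ... | just z with ζ-zero-attained f σ x e
    ... | p , sp , et with proj₁ f⪯g p sp
    ... | b , eb = ζ-zero-≤∞ g σ x p eb et

    clamp-ζ-⪯ : ∀ σ x i →
                ∃[ j ] ((i ≤ᶠ j) × (clamp G (suc l) (ζ G g σ x j) ≤ℤ clamp G (suc l) (ζ G f σ x i)))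
    clamp-ζ-⪯ σ x zero = zero , ℕ.z≤n , clamp-mono (ζ-zero-⪯ σ x)
    clamp-ζ-⪯ σ x (suc i) with ζ G f σ x (suc i) in e
    ... | nothing = suc i , ≤-refl , clamp-mono {a = ζ G g σ x (suc i)} ≤∞-top
    ... | just _ with ζ-suc-attained f σ x i e
    ... | p , a , w , ea , ew , aᵢ<0 , refl with proj₁ f⪯g p (a , ea)
    ... | b , eb with proj₂ f⪯g p a b ea eb (inject₁ i)
    ... | j , i≤j , bⱼ≤aᵢ with fromℕ-or-inject₁ l j
    ... | inj₁ refl = ⊥-elim (g∉𝓤 (g∈𝓕 , p , b , eb , ℤ.≤-<-trans bⱼ≤aᵢ aᵢ<0))
    ... | inj₂ (j' , refl) =
      suc j' , ℕ.s≤s (inject₁-≤⁻¹ i≤j) ,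
      clamp-mono (≤∞-trans (ζ-suc-≤∞ g σ x j' p eb ew (ℤ.≤-<-trans bⱼ≤aᵢ aᵢ<0))
                           (≤∞-just (ℤ.+-monoˡ-≤ w bⱼ≤aᵢ)))

    Successor-⪯-successor : ∀ {σ q} → ((o , _) : Successor G σ f q) → _⪯_ G q (successor g σ o)
    Successor-⪯-successor {σ} {q} (o , supp , value) = supp-⊆ , entries-⪯
      where
        supp-⊆ : ∀ x → Supp G q x → Supp G (successor g σ o) x
        supp-⊆ x sx = guarded-just (PostObs? g σ o x) _ (PostObs-mono (proj₁ f⪯g) (proj₁ (supp x) sx))

        entries-⪯ : ∀ x u v → q x ≡ just u → successor g σ o x ≡ just v →
                    ∀ i → ∃[ j ] ((i ≤ᶠ j) × (v j ≤ℤ u i))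
        entries-⪯ x u v eu ev i with clamp-ζ-⪯ σ x i
        ... | j , i≤j , ≤ =
          j , i≤j , subst₂ _≤ℤ_ (sym (successor-value g σ o x v ev j)) (sym (value x u eu i)) ≤

lemma8 : (G : WGA) (l : ℕ) (S : RawF G (suc l) → Set) (f g : RawF G (suc l)) →
    UpwardClosed G S →
    InF G f → ¬ 𝓤 G f → InF G g → ¬ 𝓤 G g →
    UPre G S f → _⪯_ G f g → UPre G S g
lemma8 G l S f g S↑ _ _ g∈𝓕 g∉𝓤 (_ , f∈UPre) f⪯g = g∈𝓕 , g∈UPre
  where
    g∈UPre : ∀ σ → ∃[ q ] (S q × Successor G σ g q)
    g∈UPre σ with f∈UPre σ
    ... | q , q∈S , succ@(o , _) =
      successor G g σ o
      , proj₂ (S↑ _) (successor-InF G g σ o , q , q∈S , Successor-⪯-successor G g∈𝓕 g∉𝓤 f⪯g succ)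
      , successor-isSuccessor G g σ o
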